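{- Let $d=(d_1,\ldots,d_n)$ be a sequence of positive integers, $\gamma\in[1,n]$, and $G_{d,\gamma}$ the flow network described in the context. Then (i) $\min\{c(S,T):(S,T)\in\mathscr F_1\}\le\min\{c(S,T):(S,T)\in\mathscr S_{00}\}$; (ii) $\min\{c(S,T):(S,T)\in\mathscr F_2\}\le\min\{c(S,T):(S,T)\in\mathscr S_{11}\}$; (iii) $\min\{c(S,T):(S,T)\in\mathscr F_3\}\le\min\{c(S,T):(S,T)\in\mathscr S_{10}\}$.
   Context: The network $G_{d,\gamma}$ has node set $\mathcal V=\{s,t\}\cup X\cup Y\cup X'_S\cup Y'_S$, where $X=\{x_1,\ldots,x_n\}$, $Y=\{y_1,\ldots,y_n\}$, $X_D=\{x_i:i\in[1,\gamma]\}$, $Y_D=\{y_j:j\in[1,\gamma]\}$, $X_S=\{x_i:i\in[\gamma+1,n]\}$, $Y_S=\{y_j:j\in[\gamma+1,n]\}$, $X'_S=\{x'_i:i\in[\gamma+1,n]\}$, $Y'_S=\{y'_j:j\in[\gamma+1,n]\}$. Its directed edges with capacities are: $(s,x_i)$ cap. $d_i$ and $(y_i,t)$ cap. $d_i$ for $i\in[1,n]$; $(x_i,y_j)$ cap. 1 for $i,j\in[1,\gamma]$, $i\ne j$; $(x_i,y_j)$ cap. 1 for $i\in[1,\gamma]$, $j\in[\gamma+1,n]$; $(x_i,y_j)$ cap. 1 for $i\in[\gamma+1,n]$, $j\in[1,\gamma]$; $(x_i,x'_i)$ cap. $d_i-1$ and $(y'_i,y_i)$ cap. $d_i-1$ for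 $i\in[\gamma+1,n]$; $(x'_i,y'_j)$ cap. 1 for $i,j\in[\gamma+1,n]$, $i\ne j$. An $s$-$t$ cut is a partition $(S,T)$ of $\mathcal V$ with $s\in S$, $t\in T$; its capacity $c(S,T)$ is the total capacity of edges directed from $S$ to $T$. $\mathscr S_{ab}$ ($a,b\in\{0,1\}$) is the set of $s$-$t$ cuts with [$S\cap X_D\ne\emptyset$ iff $a=1$] and [$T\cap Y_D\ne\emptyset$ iff $b=1$]. Cut families (each cut written as $(S,\mathcal V\setminus S)$, where in each case $S$ is additionally understood to contain $s$): $\mathscr F_1$: $S=\{x'_i:i\in I\}\cup\{y'_j:j\in J\}\cup X_S\cup Y_D$ for $I,J\subseteq[\gamma+1,n]$; $\mathscr F_2$: $S=\{x_i:i\in I\}\cup\{y_j:j\in J\}\cup\{x'_i:i\in I\cap[\gamma+1,n]\}\cup\{y'_j:j\in J\cap[\gamma+1,n]\}$ for $I,J\subseteq[1,n]$; $\mathscr F_3$: $S=\{x_i,x'_i:i\in I\}\cup\{y_j:j\in J\cap[1,\gamma]\}\cup\{y'_j:j\in J\cap[\gamma+1,n]\}$ for $I\subseteq[\gamma+1,n]$, $J\subseteq[1,n]$. $[a,b]=\{a,\ldots,b\}$. -}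

module Defs where

open import Data.Nat using (ℕ; zero; suc; _+_; _∸_; _≤_; _<_; _≤?_; _<?_)
open import Data.Fin using (Fin; toℕ) renaming (zero to fzero; suc to fsuc)
open import Data.Fin.Properties using (_≟_)
open import Data.Bool using (Bool; true; false; _∧_; not; if_then_else_)
open import Data.Product using (Σ; ∃; _×_; _,_)
open import Relation.Nullary using (yes; no)
open import Relation.Binary.PropositionalEquality using (_≡_)

-- Indices are 0-based: paper's index i ∈ [1,n] is Fin n element with toℕ = i-1.
-- Paper's i ∈ [1,γ]  ⟺  toℕ i < γ ;  paper's i ∈ [γ+1,n] ⟺ γ ≤ toℕ i.

data Node (n γ : ℕ) : Set where
  s t : Node n γ
  x y : Fin n → Node n γ
  x' y' : (i : Fin n) → γ ≤ toℕ i → Node n γ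

sumF : ∀ {n} → (Fin n → ℕ) → ℕ
sumF {zero} f = 0
sumF {suc n} f = f fzero + sumF (λ i → f (fsuc i))

VSet : ℕ → ℕ → Set
VSet n γ = Node n γ → Bool

edgeTerm : ∀ {n γ} → VSet n γ → Node n γ → Node n γ → ℕ → ℕ
edgeTerm S u v c = if S u ∧ not (S v) then c else 0

-- capacity of edge (x_i, y_j) (0 if no such edge)
xyCap : ∀ {n} → ℕ → Fin n → Fin n → ℕ
xyCap γ i j with toℕ i <? γ | toℕ j <? γ
... | yes _ | yes _ = if Relation.Nullary.does (i ≟ j) then 0 else 1
  where import Relation.Nullary
... | yes _ | no _ = 1
... | no _ | yes _ = 1
... | no _ | no _ = 0

primeTerm : ∀ {n γ} → (Fin n → ℕ) → VSet n γ → Fin n → ℕ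
primeTerm {n} {γ} d S i with γ ≤? toℕ i
... | yes p = edgeTerm S (x i) (x' i p) (d i ∸ 1) + edgeTerm S (y' i p) (y i) (d i ∸ 1)
... | no _ = 0

primePrimeTerm : ∀ {n γ} → VSet n γ → Fin n → Fin n → ℕ
primePrimeTerm {n} {γ} S i j with γ ≤? toℕ i | γ ≤? toℕ j
... | yes p | yes q = if Relation.Nullary.does (i ≟ j) then 0 else edgeTerm S (x' i p) (y' j q) 1
  where import Relation.Nullary
... | yes _ | no _ = 0
... | no _ | _ = 0

cutCap : ∀ {n γ} → (Fin n → ℕ) → VSet n γ → ℕ
cutCap {n} {γ} d S =
  sumF (λ i → edgeTerm S s (x i) (d i))
  + sumF (λ i → edgeTerm S (y i) t (d i))
  + sumF (λ i → sumF (λ j → edgeTerm S (x i) (y j) (xyCap γ i j)))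
  + sumF (primeTerm d S)
  + sumF (λ i → sumF (λ j → primePrimeTerm S i j))

IsCut : ∀ {n γ} → VSet n γ → Set
IsCut S = (S s ≡ true) × (S t ≡ false)

InS00 : ∀ {n γ} → VSet n γ → Set
InS00 {n} {γ} S = (∀ (i : Fin n) → toℕ i < γ → S (x i) ≡ false)
                × (∀ (j : Fin n) → toℕ j < γ → S (y j) ≡ true)

InS11 : ∀ {n γ} → VSet n γ → Set
InS11 {n} {γ} S = (∃ λ (i : Fin n) → (toℕ i < γ) × (S (x i) ≡ true))
                × (∃ λ (j : Fin n) → (toℕ j < γ) × (S (y j) ≡ false))

InS10 : ∀ {n γ} → VSet n γ → Set
InS10 {n} {γ} S = (∃ λ (i : Fin n) → (toℕ i < γ) × (S (x i) ≡ true))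
                × (∀ (j : Fin n) → toℕ j < γ → S (y j) ≡ true)

isS : ∀ {n} → ℕ → Fin n → Bool
isS γ i = Relation.Nullary.does (γ ≤? toℕ i)
  where import Relation.Nullary

isD : ∀ {n} → ℕ → Fin n → Bool
isD γ i = Relation.Nullary.does (toℕ i <? γ)
  where import Relation.Nullary

-- ℱ_1: S = {s} ∪ {x'_i : i∈I} ∪ {y'_j : j∈J} ∪ X_S ∪ Y_D, I,J ⊆ [γ+1,n]
-- (values of I, J outside [γ+1,n] are irrelevant: x'_i,y'_j only exist there)
F1set : ∀ {n γ} → (I J : Fin n → Bool) → VSet n γ
F1set I J s = true
F1set I J t = false
F1set {γ = γ} I J (x i) = isS γ i
F1set {γ = γ} I J (y j) = isD γ j
F1set I J (x' i _) = I i
F1set I J (y' j _) = J j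

-- ℱ_2: S = {s} ∪ {x_i : i∈I} ∪ {y_j : j∈J} ∪ {x'_i : i∈I∩[γ+1,n]} ∪ {y'_j : j∈J∩[γ+1,n]}
F2set : ∀ {n γ} → (I J : Fin n → Bool) → VSet n γ
F2set I J s = true
F2set I J t = false
F2set I J (x i) = I i
F2set I J (y j) = J j
F2set I J (x' i _) = I i
F2set I J (y' j _) = J j

-- ℱ_3: S = {s} ∪ {x_i, x'_i : i∈I} ∪ {y_j : j∈J∩[1,γ]} ∪ {y'_j : j∈J∩[γ+1,n]},
-- I ⊆ [γ+1,n] (encoded by intersecting with [γ+1,n]), J ⊆ [1,n]
F3set : ∀ {n γ} → (I J : Fin n → Bool) → VSet n γ
F3set I J s = true
F3set I J t = false
F3set {γ = γ} I J (x i) = I i ∧ isS γ i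
F3set {γ = γ} I J (y j) = J j ∧ isD γ j
F3set I J (x' i _) = I i
F3set I J (y' j _) = J j

{-# OPTIONS --safe #-}
module Submission where

-- Regroup c(S) into one row per index i (the edges s→x_i, y_i→t and, for i > γ, x_i→x'_i and
-- y'_i→y_i), the unit edges x→y and the unit edges x'→y'; the witness is built from S gadget by
-- gadget.  In (i), X_S joins and Y_S leaves the source side, which only removes edges from the
-- cut because S ∩ X_D = ∅ and Y_D ⊆ S.  In (ii) and (iii), a gadget with x_i ∈ S, x'_i ∉ S (or
-- y'_i ∈ S, y_i ∉ S) is made uniform, which may raise its row by one unit (d_i instead of
-- d_i − 1); that unit is recovered from a unit edge x_i→y_b or x_a→y_i (a, b ≤ γ, x_a ∈ S,
-- y_b ∉ S) that S cuts and the witness does not: this is where S ∈ 𝒮₁₁, 𝒮₁₀ is used.  In (iii)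
-- all of X_D leaves the source side and y_j (j ≤ γ) takes the place of x_j, so x→y edges are
-- compared with their transposes and x'→y' edges in symmetric pairs (i,j), (j,i).

open import Defs
open import Data.Bool using (Bool; true; false; not; _∧_; _∨_; if_then_else_; f≤t; b≤b)
  renaming (_≤_ to _≤ᴮ_)
open import Data.Bool.Properties using (∧-identityʳ; ∧-zeroʳ; ∧-comm; if-eta)
  renaming (≤-reflexive to ≤ᴮ-reflexive; ≤-trans to ≤ᴮ-trans; ≤-minimum to ≤ᴮ-minimum)
open import Data.Fin using (Fin; toℕ; punchIn) renaming (zero to fzero; suc to fsuc)
open import Data.Fin.Properties using (_≟_)
open import Data.Nat using (ℕ; zero; suc; _+_; _∸_; _≤_; _<_; _≤?_; _<?_; z≤n)
open import Data.Nat.Properties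
  using (+-0-commutativeMonoid; +-commutativeSemigroup; ≤-refl; ≤-trans; ≤-reflexive; ≤-irrelevant;
         +-mono-≤; +-monoˡ-≤; +-monoʳ-≤; +-mono-<; +-identityʳ; +-comm; +-assoc; <⇒≱; ≰⇒>;
         m≤m+n; m≤n+m; m∸n≤m; m∸n+n≡m; module ≤-Reasoning)
open import Data.Product using (_×_; _,_; ∃₂)
open import Data.Sum using (_⊎_; inj₁; inj₂)
open import Data.Vec.Functional using (removeAt)
open import Function using (_∘_)
open import Relation.Binary.PropositionalEquality
  using (_≡_; refl; sym; trans; cong; cong₂; subst; subst₂; module ≡-Reasoning)
open import Relation.Nullary using (yes; no; ¬_; contradiction)
open import Relation.Nullary.Decidable using (dec-true; dec-false; toSum)
open import Algebra.Properties.CommutativeMonoid.Sum +-0-commutativeMonoid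
  using (sum; sum-syntax; ∑-distrib-+; ∑-comm; sum-remove; sum-cong-≗; sum-replicate-zero)
open import Algebra.Properties.CommutativeSemigroup +-commutativeSemigroup
  using (interchange; xy∙z≈xz∙y; xy∙z≈x∙zy)

sumF≡∑ : ∀ {n} (f : Fin n → ℕ) → sumF f ≡ ∑[ i < n ] f i
sumF≡∑ {zero}  f = refl
sumF≡∑ {suc n} f = cong (f fzero +_) (sumF≡∑ (f ∘ fsuc))

∑-mono-≤ : ∀ {n} {f g : Fin n → ℕ} → (∀ i → f i ≤ g i) → ∑[ i < n ] f i ≤ ∑[ i < n ] g i
∑-mono-≤ {zero}  f≤g = z≤n
∑-mono-≤ {suc n} f≤g = +-mono-≤ (f≤g fzero) (∑-mono-≤ (f≤g ∘ fsuc))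

∑-mono-≤-with-slack : ∀ {n} {f g : Fin n → ℕ} {c : ℕ} (a : Fin n) →
  (∀ i → f i ≤ g i) → f a + c ≤ g a → ∑[ i < n ] f i + c ≤ ∑[ i < n ] g i
∑-mono-≤-with-slack {suc n} {f} {g} {c} a f≤g slack = begin
  sum f + c                          ≡⟨ cong (_+ c) (sum-remove {i = a} f) ⟩
  f a + sum (removeAt f a) + c       ≡⟨ xy∙z≈xz∙y (f a) _ c ⟩
  f a + c + sum (removeAt f a)       ≤⟨ +-mono-≤ slack (∑-mono-≤ (f≤g ∘ punchIn a)) ⟩
  g a + sum (removeAt g a)           ≡⟨ sym (sum-remove {i = a} g) ⟩
  sum g                              ∎
  where open ≤-Reasoning

∑∑-mono-≤-with-slack : ∀ {n} {f g : Fin n → Fin n → ℕ} {u v : Fin n → ℕ} (a b : Fin n) →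
  (∀ i j → f i j ≤ g i j) → (∀ i → f i b + u i ≤ g i b) → (∀ j → f a j + v j ≤ g a j) → u a ≡ 0 →
  ∑[ i < n ] ∑[ j < n ] f i j + ∑[ i < n ] u i + ∑[ j < n ] v j ≤ ∑[ i < n ] ∑[ j < n ] g i j
∑∑-mono-≤-with-slack {n} {f} {g} {u} {v} a b f≤g column row uₐ≡0 = begin
  ∑[ i < n ] ∑[ j < n ] f i j + ∑[ i < n ] u i + ∑[ j < n ] v j
    ≡⟨ cong (_+ ∑[ j < n ] v j) (sym (∑-distrib-+ (λ i → ∑[ j < n ] f i j) u)) ⟩
  ∑[ i < n ] (∑[ j < n ] f i j + u i) + ∑[ j < n ] v j
    ≤⟨ ∑-mono-≤-with-slack a (λ i → ∑-mono-≤-with-slack b (f≤g i) (column i)) rowₐ ⟩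
  ∑[ i < n ] ∑[ j < n ] g i j ∎
  where
  open ≤-Reasoning
  rowₐ : ∑[ j < n ] f a j + u a + ∑[ j < n ] v j ≤ ∑[ j < n ] g a j
  rowₐ = begin
    ∑[ j < n ] f a j + u a + ∑[ j < n ] v j   ≡⟨ cong (λ c → ∑[ j < n ] f a j + c + ∑[ j < n ] v j) uₐ≡0 ⟩
    ∑[ j < n ] f a j + 0 + ∑[ j < n ] v j     ≡⟨ cong (_+ ∑[ j < n ] v j) (+-identityʳ _) ⟩
    ∑[ j < n ] f a j + ∑[ j < n ] v j         ≡⟨ sym (∑-distrib-+ (f a) v) ⟩
    ∑[ j < n ] (f a j + v j)                  ≤⟨ ∑-mono-≤ row ⟩
    ∑[ j < n ] g a j                          ∎

m+m≤n+n⇒m≤n : ∀ {m n} → m + m ≤ n + n → m ≤ n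
m+m≤n+n⇒m≤n {m} {n} m+m≤n+n with m ≤? n
... | yes m≤n = m≤n
... | no  m≰n = contradiction m+m≤n+n (<⇒≱ (+-mono-< (≰⇒> m≰n) (≰⇒> m≰n)))

∑∑-symmetrised : ∀ {n} (f : Fin n → Fin n → ℕ) →
  ∑[ i < n ] ∑[ j < n ] (f i j + f j i) ≡ ∑[ i < n ] ∑[ j < n ] f i j + ∑[ i < n ] ∑[ j < n ] f i j
∑∑-symmetrised {n} f = begin
  ∑[ i < n ] ∑[ j < n ] (f i j + f j i)
    ≡⟨ sum-cong-≗ (λ i → ∑-distrib-+ (f i) (λ j → f j i)) ⟩
  ∑[ i < n ] (∑[ j < n ] f i j + ∑[ j < n ] f j i)
    ≡⟨ ∑-distrib-+ (λ i → ∑[ j < n ] f i j) _ ⟩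
  ∑[ i < n ] ∑[ j < n ] f i j + ∑[ i < n ] ∑[ j < n ] f j i
    ≡⟨ cong (∑[ i < n ] ∑[ j < n ] f i j +_) (∑-comm f) ⟨
  ∑[ i < n ] ∑[ j < n ] f i j + ∑[ i < n ] ∑[ j < n ] f i j ∎
  where open ≡-Reasoning

∑∑-mono-≤-pairwise : ∀ {n} {f g : Fin n → Fin n → ℕ} → (∀ i j → f i j + f j i ≤ g i j + g j i) →
  ∑[ i < n ] ∑[ j < n ] f i j ≤ ∑[ i < n ] ∑[ j < n ] g i j
∑∑-mono-≤-pairwise {f = f} {g} pair≤ =
  m+m≤n+n⇒m≤n (subst₂ _≤_ (∑∑-symmetrised f) (∑∑-symmetrised g) (∑-mono-≤ (∑-mono-≤ ∘ pair≤)))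

𝟙 : Bool → ℕ
𝟙 b = if b then 1 else 0

ifAndNot-mono : ∀ {a a' b b' : Bool} {c : ℕ} → a' ≤ᴮ a → b ≤ᴮ b' →
  (if a' ∧ not b' then c else 0) ≤ (if a ∧ not b then c else 0)
ifAndNot-mono f≤t _ = z≤n
ifAndNot-mono {true}  b≤b f≤t = z≤n
ifAndNot-mono {false} b≤b f≤t = z≤n
ifAndNot-mono b≤b b≤b = ≤-refl

≤-+zero : ∀ {m n u} → u ≡ 0 → m ≤ n → m + u ≤ n
≤-+zero {m} refl m≤n = ≤-trans (≤-reflexive (+-identityʳ m)) m≤n

d+0≤d∸1+1 : ∀ {d} → 1 ≤ d → d + 0 ≤ d ∸ 1 + 1
d+0≤d∸1+1 {d} 1≤d = ≤-reflexive (trans (+-identityʳ d) (sym (m∸n+n≡m 1≤d)))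

-- Dense indices (toℕ i < γ) are those of X_D and Y_D, sparse ones (γ ≤ toℕ i) those of X_S, Y_S.
module _ {n γ : ℕ} where

  -- Case splits use this instead of `with γ ≤? toℕ i`: the latter also abstracts that decision
  -- where it occurs inside primeTerm, isS or bySide in the goal, which then no longer matches
  -- the statements of the lemmas below.
  sparse-or-dense : (i : Fin n) → γ ≤ toℕ i ⊎ ¬ γ ≤ toℕ i
  sparse-or-dense i = toSum (γ ≤? toℕ i)

  isS-sparse : {i : Fin n} → γ ≤ toℕ i → isS γ i ≡ true
  isS-sparse {i} = dec-true (γ ≤? toℕ i)

  isS-dense : {i : Fin n} → ¬ γ ≤ toℕ i → isS γ i ≡ false
  isS-dense {i} = dec-false (γ ≤? toℕ i)

  isD-sparse : {i : Fin n} → γ ≤ toℕ i → isD γ i ≡ false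
  isD-sparse {i} p = dec-false (toℕ i <? γ) (λ i<γ → <⇒≱ i<γ p)

  isD-dense : {i : Fin n} → ¬ γ ≤ toℕ i → isD γ i ≡ true
  isD-dense {i} ¬p = dec-true (toℕ i <? γ) (≰⇒> ¬p)

  xyCap-sparse-sparse : {i j : Fin n} → γ ≤ toℕ i → γ ≤ toℕ j → xyCap γ i j ≡ 0
  xyCap-sparse-sparse {i} {j} p q with toℕ i <? γ | toℕ j <? γ
  ... | yes i<γ | _       = contradiction p (<⇒≱ i<γ)
  ... | no _    | yes j<γ = contradiction q (<⇒≱ j<γ)
  ... | no _    | no _    = refl

  xyCap-sparse-dense : {i j : Fin n} → γ ≤ toℕ i → ¬ γ ≤ toℕ j → xyCap γ i j ≡ 1
  xyCap-sparse-dense {i} {j} p ¬q with toℕ i <? γ | toℕ j <? γ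
  ... | yes i<γ | _      = contradiction p (<⇒≱ i<γ)
  ... | no _    | yes _  = refl
  ... | no _    | no j≮γ = contradiction (≰⇒> ¬q) j≮γ

  xyCap-dense-sparse : {i j : Fin n} → ¬ γ ≤ toℕ i → γ ≤ toℕ j → xyCap γ i j ≡ 1
  xyCap-dense-sparse {i} {j} ¬p q with toℕ i <? γ | toℕ j <? γ
  ... | no i≮γ | _       = contradiction (≰⇒> ¬p) i≮γ
  ... | yes _  | yes j<γ = contradiction q (<⇒≱ j<γ)
  ... | yes _  | no _    = refl

  primeTerm-sparse : (d : Fin n → ℕ) (T : VSet n γ) {i : Fin n} (p : γ ≤ toℕ i) →
    primeTerm d T i ≡ edgeTerm T (x i) (x' i p) (d i ∸ 1) + edgeTerm T (y' i p) (y i) (d i ∸ 1)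
  primeTerm-sparse d T {i} p with γ ≤? toℕ i
  ... | yes q rewrite ≤-irrelevant p q = refl
  ... | no ¬p = contradiction p ¬p

  primeTerm-dense : (d : Fin n → ℕ) (T : VSet n γ) {i : Fin n} → ¬ γ ≤ toℕ i → primeTerm d T i ≡ 0
  primeTerm-dense d T {i} ¬p with γ ≤? toℕ i
  ... | yes p = contradiction p ¬p
  ... | no _  = refl

  -- The sparse part may inspect x' i p and y' i p, which exist only for sparse i.
  bySide : {A : Set} → (Fin n → A) → ((i : Fin n) → γ ≤ toℕ i → A) → Fin n → A
  bySide dense sparse i with γ ≤? toℕ i
  ... | yes p = sparse i p
  ... | no _  = dense i

  bySide-sparse : ∀ {A : Set} {dense : Fin n → A} {sparse} {i : Fin n} (p : γ ≤ toℕ i) →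
    bySide dense sparse i ≡ sparse i p
  bySide-sparse {sparse = sparse} {i} p with γ ≤? toℕ i
  ... | yes q = cong (sparse i) (≤-irrelevant q p)
  ... | no ¬p = contradiction p ¬p

  bySide-dense : ∀ {A : Set} {dense : Fin n → A} {sparse} {i : Fin n} → ¬ γ ≤ toℕ i →
    bySide dense sparse i ≡ dense i
  bySide-dense {i = i} ¬p with γ ≤? toℕ i
  ... | yes p = contradiction p ¬p
  ... | no _  = refl

  xyTerm : VSet n γ → Fin n → Fin n → ℕ
  xyTerm T i j = edgeTerm T (x i) (y j) (xyCap γ i j)

  xyTerm-sparse-sparse : (T : VSet n γ) {i j : Fin n} → γ ≤ toℕ i → γ ≤ toℕ j → xyTerm T i j ≡ 0
  xyTerm-sparse-sparse T {i} {j} p q =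
    trans (cong (λ c → if T (x i) ∧ not (T (y j)) then c else 0) (xyCap-sparse-sparse p q)) (if-eta _)

  xyTerm-sparse-dense : (T : VSet n γ) {i j : Fin n} → γ ≤ toℕ i → ¬ γ ≤ toℕ j →
    xyTerm T i j ≡ 𝟙 (T (x i) ∧ not (T (y j)))
  xyTerm-sparse-dense T {i} {j} p ¬q =
    cong (λ c → if T (x i) ∧ not (T (y j)) then c else 0) (xyCap-sparse-dense p ¬q)

  xyTerm-dense-sparse : (T : VSet n γ) {i j : Fin n} → ¬ γ ≤ toℕ i → γ ≤ toℕ j →
    xyTerm T i j ≡ 𝟙 (T (x i) ∧ not (T (y j)))
  xyTerm-dense-sparse T {i} {j} ¬p q =
    cong (λ c → if T (x i) ∧ not (T (y j)) then c else 0) (xyCap-dense-sparse ¬p q)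

  crossTerm : VSet n γ → (i j : Fin n) → γ ≤ toℕ i → γ ≤ toℕ j → ℕ
  crossTerm T i j p q = edgeTerm T (x' i p) (y' j q) 1 + edgeTerm T (x' j q) (y' i p) 1

  ∑∑primePrimeTerm-≤ : (F S : VSet n γ) →
    (∀ i j (p : γ ≤ toℕ i) (q : γ ≤ toℕ j) → crossTerm F i j p q ≤ crossTerm S i j p q) →
    ∑[ i < n ] ∑[ j < n ] primePrimeTerm F i j ≤ ∑[ i < n ] ∑[ j < n ] primePrimeTerm S i j
  ∑∑primePrimeTerm-≤ F S cross≤ = ∑∑-mono-≤-pairwise pair≤
    where
    pair≤ : ∀ i j → primePrimeTerm F i j + primePrimeTerm F j i ≤ primePrimeTerm S i j + primePrimeTerm S j i
    pair≤ i j with γ ≤? toℕ i | γ ≤? toℕ j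
    ... | no _  | no _  = z≤n
    ... | no _  | yes _ = z≤n
    ... | yes _ | no _  = z≤n
    ... | yes p | yes q with i ≟ j | j ≟ i
    ...   | yes _   | yes _   = z≤n
    ...   | no _    | no _    = cross≤ i j p q
    ...   | yes i≡j | no j≢i  = contradiction (sym i≡j) j≢i
    ...   | no i≢j  | yes j≡i = contradiction (sym j≡i) i≢j

  ∑∑primePrimeTerm-mono : (F S : VSet n γ) →
    (∀ i p → F (x' i p) ≤ᴮ S (x' i p)) → (∀ j q → S (y' j q) ≤ᴮ F (y' j q)) →
    ∑[ i < n ] ∑[ j < n ] primePrimeTerm F i j ≤ ∑[ i < n ] ∑[ j < n ] primePrimeTerm S i j
  ∑∑primePrimeTerm-mono F S x'≤ y'≥ = ∑∑primePrimeTerm-≤ F S λ i j p q →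
    +-mono-≤ (ifAndNot-mono (x'≤ i p) (y'≥ j q)) (ifAndNot-mono (x'≤ j q) (y'≥ i p))

module _ {n γ : ℕ} (T : VSet n γ) {c : ℕ} where

  edgeTerm-from-s : T s ≡ true → (v : Node n γ) → edgeTerm T s v c ≡ (if not (T v) then c else 0)
  edgeTerm-from-s Ts v = cong (λ b → if b ∧ not (T v) then c else 0) Ts

  edgeTerm-to-t : T t ≡ false → (u : Node n γ) → edgeTerm T u t c ≡ (if T u then c else 0)
  edgeTerm-to-t Tt u =
    trans (cong (λ b → if T u ∧ not b then c else 0) Tt) (cong (λ b → if b then c else 0) (∧-identityʳ (T u)))

sourceCost sinkCost denseCost : ℕ → Bool → Bool → ℕ
sourceCost d a c = (if not a then d else 0) + (if a ∧ not c then d ∸ 1 else 0)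
sinkCost d b e = (if b then d else 0) + (if not b ∧ e then d ∸ 1 else 0)
denseCost d a b = (if not a then d else 0) + (if b then d else 0)

module _ {n γ : ℕ} (d : Fin n → ℕ) where

  row : VSet n γ → Fin n → ℕ
  row T i = edgeTerm T s (x i) (d i) + edgeTerm T (y i) t (d i) + primeTerm d T i

  sumF²≡∑∑ : (f : Fin n → Fin n → ℕ) → sumF (λ i → sumF (f i)) ≡ ∑[ i < n ] ∑[ j < n ] f i j
  sumF²≡∑∑ f = trans (sumF≡∑ (λ i → sumF (f i))) (sum-cong-≗ (sumF≡∑ ∘ f))

  cutCap-regroup : (T : VSet n γ) → cutCap d T ≡
    ∑[ i < n ] row T i + ∑[ i < n ] ∑[ j < n ] xyTerm T i j + ∑[ i < n ] ∑[ j < n ] primePrimeTerm T i j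
  cutCap-regroup T = begin
    cutCap d T
      ≡⟨ cong₂ _+_ (cong₂ _+_ (cong₂ _+_ (cong₂ _+_ (sumF≡∑ source) (sumF≡∑ sink))
                                         (sumF²≡∑∑ (xyTerm T)))
                             (sumF≡∑ prime))
                   (sumF²≡∑∑ (primePrimeTerm T)) ⟩
    sum source + sum sink + ∑∑xy + sum prime + ∑∑pp
      ≡⟨ cong (_+ ∑∑pp) (xy∙z≈xz∙y (sum source + sum sink) ∑∑xy (sum prime)) ⟩
    sum source + sum sink + sum prime + ∑∑xy + ∑∑pp
      ≡⟨ cong (λ r → r + ∑∑xy + ∑∑pp)
           (sym (trans (∑-distrib-+ _ prime) (cong (_+ sum prime) (∑-distrib-+ source sink)))) ⟩
    sum (row T) + ∑∑xy + ∑∑pp ∎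
    where
    open ≡-Reasoning
    source sink prime : Fin n → ℕ
    source i = edgeTerm T s (x i) (d i)
    sink i = edgeTerm T (y i) t (d i)
    prime = primeTerm d T
    ∑∑xy ∑∑pp : ℕ
    ∑∑xy = ∑[ i < n ] ∑[ j < n ] xyTerm T i j
    ∑∑pp = ∑[ i < n ] ∑[ j < n ] primePrimeTerm T i j

  cutCap-≤ : (F S : VSet n γ) (cr : Fin n → ℕ) →
    (∀ i → row F i ≤ row S i + cr i) →
    ∑[ i < n ] ∑[ j < n ] xyTerm F i j + ∑[ i < n ] cr i ≤ ∑[ i < n ] ∑[ j < n ] xyTerm S i j →
    ∑[ i < n ] ∑[ j < n ] primePrimeTerm F i j ≤ ∑[ i < n ] ∑[ j < n ] primePrimeTerm S i j →
    cutCap d F ≤ cutCap d S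
  cutCap-≤ F S cr rows xys pps = begin
    cutCap d F                               ≡⟨ cutCap-regroup F ⟩
    sum (row F) + ∑∑xy F + ∑∑pp F            ≤⟨ +-mono-≤ (+-monoˡ-≤ (∑∑xy F) rowSum) pps ⟩
    sum (row S) + sum cr + ∑∑xy F + ∑∑pp S   ≡⟨ cong (_+ ∑∑pp S) (xy∙z≈x∙zy _ (sum cr) (∑∑xy F)) ⟩
    sum (row S) + (∑∑xy F + sum cr) + ∑∑pp S ≤⟨ +-monoˡ-≤ (∑∑pp S) (+-monoʳ-≤ (sum (row S)) xys) ⟩
    sum (row S) + ∑∑xy S + ∑∑pp S            ≡⟨ cutCap-regroup S ⟨
    cutCap d S                               ∎
    where
    open ≤-Reasoning
    ∑∑xy ∑∑pp : VSet n γ → ℕ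
    ∑∑xy T = ∑[ i < n ] ∑[ j < n ] xyTerm T i j
    ∑∑pp T = ∑[ i < n ] ∑[ j < n ] primePrimeTerm T i j
    rowSum : sum (row F) ≤ sum (row S) + sum cr
    rowSum = ≤-trans (∑-mono-≤ rows) (≤-reflexive (∑-distrib-+ (row S) cr))

  cutCap-mono : (F S : VSet n γ) →
    (∀ i → row F i ≤ row S i) → (∀ i j → xyTerm F i j ≤ xyTerm S i j) →
    ∑[ i < n ] ∑[ j < n ] primePrimeTerm F i j ≤ ∑[ i < n ] ∑[ j < n ] primePrimeTerm S i j →
    cutCap d F ≤ cutCap d S
  cutCap-mono F S rows xys = cutCap-≤ F S (λ _ → 0) (λ i → ≤-trans (rows i) (m≤m+n _ 0)) xys+0
    where
    xys+0 : ∑[ i < n ] ∑[ j < n ] xyTerm F i j + ∑[ i < n ] 0 ≤ ∑[ i < n ] ∑[ j < n ] xyTerm S i j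
    xys+0 = subst (_≤ ∑[ i < n ] ∑[ j < n ] xyTerm S i j)
                  (sym (trans (cong (∑[ i < n ] ∑[ j < n ] xyTerm F i j +_) (sum-replicate-zero n)) (+-identityʳ _)))
                  (∑-mono-≤ (∑-mono-≤ ∘ xys))

  row-sparse : (T : VSet n γ) → IsCut T → {i : Fin n} (p : γ ≤ toℕ i) →
    row T i ≡ sourceCost (d i) (T (x i)) (T (x' i p)) + sinkCost (d i) (T (y i)) (T (y' i p))
  row-sparse T (Ts , Tt) {i} p =
    trans (cong₂ _+_ (cong₂ _+_ (edgeTerm-from-s T Ts (x i)) (edgeTerm-to-t T Tt (y i))) (primeTerm-sparse d T p))
   (trans (interchange (if not (T (x i)) then d i else 0) (if T (y i) then d i else 0)
                       (edgeTerm T (x i) (x' i p) (d i ∸ 1)) (edgeTerm T (y' i p) (y i) (d i ∸ 1)))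
          (cong (λ b → sourceCost (d i) (T (x i)) (T (x' i p))
                       + ((if T (y i) then d i else 0) + (if b then d i ∸ 1 else 0)))
                (∧-comm (T (y' i p)) (not (T (y i))))))

  row-dense : (T : VSet n γ) → IsCut T → {i : Fin n} → ¬ γ ≤ toℕ i →
    row T i ≡ denseCost (d i) (T (x i)) (T (y i))
  row-dense T (Ts , Tt) {i} ¬p =
    trans (cong₂ _+_ (cong₂ _+_ (edgeTerm-from-s T Ts (x i)) (edgeTerm-to-t T Tt (y i))) (primeTerm-dense d T ¬p))
          (+-identityʳ _)

sourceCost-true≤ : ∀ d a c → sourceCost d true c ≤ sourceCost d a c
sourceCost-true≤ d true  c     = ≤-refl
sourceCost-true≤ d false true  = z≤n
sourceCost-true≤ d false false = ≤-trans (m∸n≤m d 1) (m≤m+n d 0)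

sinkCost-false≤ : ∀ d b e → sinkCost d false e ≤ sinkCost d b e
sinkCost-false≤ d false e     = ≤-refl
sinkCost-false≤ d true  true  = ≤-trans (m∸n≤m d 1) (m≤m+n d 0)
sinkCost-false≤ d true  false = z≤n

module From𝒮₀₀ {n γ : ℕ} (d : Fin n → ℕ) (S : VSet n γ) (cut : IsCut S)
  (noXD : ∀ i → toℕ i < γ → S (x i) ≡ false) (allYD : ∀ j → toℕ j < γ → S (y j) ≡ true) where

  I J : Fin n → Bool
  I = bySide (λ _ → false) (λ i p → S (x' i p))
  J = bySide (λ _ → false) (λ j q → S (y' j q))

  F : VSet n γ
  F = F1set I J

  row≤ : ∀ i → row d F i ≤ row d S i
  row≤ i with sparse-or-dense {γ = γ} i
  ... | inj₁ p = begin
    row d F i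
      ≡⟨ row-sparse d F (refl , refl) p ⟩
    sourceCost (d i) (isS γ i) (I i) + sinkCost (d i) (isD γ i) (J i)
      ≡⟨ cong₂ _+_ (cong₂ (sourceCost (d i)) (isS-sparse p) (bySide-sparse p))
                   (cong₂ (sinkCost (d i)) (isD-sparse p) (bySide-sparse p)) ⟩
    sourceCost (d i) true (S (x' i p)) + sinkCost (d i) false (S (y' i p))
      ≤⟨ +-mono-≤ (sourceCost-true≤ (d i) (S (x i)) (S (x' i p)))
                  (sinkCost-false≤ (d i) (S (y i)) (S (y' i p))) ⟩
    sourceCost (d i) (S (x i)) (S (x' i p)) + sinkCost (d i) (S (y i)) (S (y' i p))
      ≡⟨ row-sparse d S cut p ⟨
    row d S i ∎
    where open ≤-Reasoning
  ... | inj₂ ¬p = ≤-reflexive (begin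
    row d F i                            ≡⟨ row-dense d F (refl , refl) ¬p ⟩
    denseCost (d i) (isS γ i) (isD γ i)
      ≡⟨ cong₂ (denseCost (d i)) (trans (isS-dense ¬p) (sym (noXD i (≰⇒> ¬p))))
                                 (trans (isD-dense ¬p) (sym (allYD i (≰⇒> ¬p)))) ⟩
    denseCost (d i) (S (x i)) (S (y i))  ≡⟨ row-dense d S cut ¬p ⟨
    row d S i                            ∎)
    where open ≡-Reasoning

  xyTerm≡0 : ∀ i j → xyTerm F i j ≡ 0
  xyTerm≡0 i j with sparse-or-dense {γ = γ} i | sparse-or-dense {γ = γ} j
  ... | inj₂ ¬p | _       = cong (λ a → if a ∧ not (isD γ j) then xyCap γ i j else 0) (isS-dense ¬p)
  ... | inj₁ p  | inj₂ ¬q = cong₂ (λ a b → if a ∧ not b then xyCap γ i j else 0) (isS-sparse p) (isD-dense ¬q)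
  ... | inj₁ p  | inj₁ q  = xyTerm-sparse-sparse F p q

  toℱ₁ : ∃₂ λ I J → cutCap d (F1set {n} {γ} I J) ≤ cutCap d S
  toℱ₁ = I , J , cutCap-mono d F S row≤ (λ i j → subst (_≤ xyTerm S i j) (sym (xyTerm≡0 i j)) z≤n)
    (∑∑primePrimeTerm-mono F S (λ _ p → ≤ᴮ-reflexive (bySide-sparse p))
                               (λ _ q → ≤ᴮ-reflexive (sym (bySide-sparse q))))

∧-≤ᴮˡ : ∀ a b → a ∧ b ≤ᴮ a
∧-≤ᴮˡ false b     = b≤b
∧-≤ᴮˡ true  false = f≤t
∧-≤ᴮˡ true  true  = b≤b

∧-≤ᴮʳ : ∀ a b → a ∧ b ≤ᴮ b
∧-≤ᴮʳ false false = b≤b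
∧-≤ᴮʳ false true  = f≤t
∧-≤ᴮʳ true  b     = b≤b

∨-≥ᴮˡ : ∀ a b → a ≤ᴮ a ∨ b
∨-≥ᴮˡ false false = b≤b
∨-≥ᴮˡ false true  = f≤t
∨-≥ᴮˡ true  b     = b≤b

∨-≥ᴮʳ : ∀ a b → b ≤ᴮ a ∨ b
∨-≥ᴮʳ false b     = b≤b
∨-≥ᴮʳ true  false = f≤t
∨-≥ᴮʳ true  true  = b≤b

sourceCost-merge : ∀ {d} → 1 ≤ d → ∀ a c →
  sourceCost d (a ∧ c) (a ∧ c) ≤ sourceCost d a c + 𝟙 (a ∧ not c)
sourceCost-merge {d} 1≤d false c     = m≤m+n (d + 0) 0
sourceCost-merge     1≤d true  true  = z≤n
sourceCost-merge     1≤d true  false = d+0≤d∸1+1 1≤d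

sinkCost-merge : ∀ {d} → 1 ≤ d → ∀ b e →
  sinkCost d (b ∨ e) (b ∨ e) ≤ sinkCost d b e + 𝟙 (not b ∧ e)
sinkCost-merge {d} 1≤d true  e     = m≤m+n (d + 0) 0
sinkCost-merge     1≤d false true  = d+0≤d∸1+1 1≤d
sinkCost-merge     1≤d false false = z≤n

𝟙-split-∧ : ∀ a b → 𝟙 ((a ∧ b) ∧ true) + 𝟙 (a ∧ not b) ≤ 𝟙 (a ∧ true)
𝟙-split-∧ false b     = z≤n
𝟙-split-∧ true  false = ≤-refl
𝟙-split-∧ true  true  = ≤-refl

𝟙-split-∨ : ∀ b e → 𝟙 (not (b ∨ e)) + 𝟙 (not b ∧ e) ≤ 𝟙 (not b)
𝟙-split-∨ true  e     = z≤n
𝟙-split-∨ false false = ≤-refl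
𝟙-split-∨ false true  = ≤-refl

module From𝒮₁₁ {n γ : ℕ} (d : Fin n → ℕ) (d≥1 : ∀ i → 1 ≤ d i) (S : VSet n γ) (cut : IsCut S)
  (a : Fin n) (a-dense : ¬ γ ≤ toℕ a) (Sxa : S (x a) ≡ true)
  (b : Fin n) (b-dense : ¬ γ ≤ toℕ b) (Syb : S (y b) ≡ false) where

  I J : Fin n → Bool
  I = bySide (λ i → S (x i)) (λ i p → S (x i) ∧ S (x' i p))
  J = bySide (λ j → S (y j)) (λ j q → S (y j) ∨ S (y' j q))

  F : VSet n γ
  F = F2set I J

  -- Row i of F may exceed row i of S by cx i + cy i; the x→y edges of column b and of row a
  -- that S cuts and F does not pay for these units.
  cx cy : Fin n → ℕ
  cx = bySide (λ _ → 0) (λ i p → 𝟙 (S (x i) ∧ not (S (x' i p))))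
  cy = bySide (λ _ → 0) (λ j q → 𝟙 (not (S (y j)) ∧ S (y' j q)))

  I≤ : ∀ i → I i ≤ᴮ S (x i)
  I≤ i with sparse-or-dense {γ = γ} i
  ... | inj₁ p  = subst (_≤ᴮ S (x i)) (sym (bySide-sparse p)) (∧-≤ᴮˡ _ _)
  ... | inj₂ ¬p = ≤ᴮ-reflexive (bySide-dense ¬p)

  J≥ : ∀ j → S (y j) ≤ᴮ J j
  J≥ j with sparse-or-dense {γ = γ} j
  ... | inj₁ q  = subst (S (y j) ≤ᴮ_) (sym (bySide-sparse q)) (∨-≥ᴮˡ _ _)
  ... | inj₂ ¬q = ≤ᴮ-reflexive (sym (bySide-dense ¬q))

  row≤-sparse : ∀ i (p : γ ≤ toℕ i) → row d F i ≤ row d S i + (cx i + cy i)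
  row≤-sparse i p = begin
    row d F i
      ≡⟨ row-sparse d F (refl , refl) p ⟩
    sourceCost (d i) (I i) (I i) + sinkCost (d i) (J i) (J i)
      ≡⟨ cong₂ _+_ (cong (λ u → sourceCost (d i) u u) (bySide-sparse p))
                   (cong (λ w → sinkCost (d i) w w) (bySide-sparse p)) ⟩
    sourceCost (d i) (xᵢ ∧ x'ᵢ) (xᵢ ∧ x'ᵢ) + sinkCost (d i) (yᵢ ∨ y'ᵢ) (yᵢ ∨ y'ᵢ)
      ≤⟨ +-mono-≤ (sourceCost-merge (d≥1 i) xᵢ x'ᵢ) (sinkCost-merge (d≥1 i) yᵢ y'ᵢ) ⟩
    sourceCost (d i) xᵢ x'ᵢ + 𝟙 (xᵢ ∧ not x'ᵢ) + (sinkCost (d i) yᵢ y'ᵢ + 𝟙 (not yᵢ ∧ y'ᵢ))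
      ≡⟨ interchange (sourceCost (d i) xᵢ x'ᵢ) _ _ _ ⟩
    sourceCost (d i) xᵢ x'ᵢ + sinkCost (d i) yᵢ y'ᵢ + (𝟙 (xᵢ ∧ not x'ᵢ) + 𝟙 (not yᵢ ∧ y'ᵢ))
      ≡⟨ cong₂ _+_ (row-sparse d S cut p) (cong₂ _+_ (bySide-sparse p) (bySide-sparse p)) ⟨
    row d S i + (cx i + cy i) ∎
    where
    open ≤-Reasoning
    xᵢ x'ᵢ yᵢ y'ᵢ : Bool
    xᵢ = S (x i)
    x'ᵢ = S (x' i p)
    yᵢ = S (y i)
    y'ᵢ = S (y' i p)

  row≤ : ∀ i → row d F i ≤ row d S i + (cx i + cy i)
  row≤ i with sparse-or-dense {γ = γ} i
  ... | inj₁ p  = row≤-sparse i p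
  ... | inj₂ ¬p = ≤-trans (≤-reflexive F≡S) (m≤m+n _ _)
    where
    F≡S : row d F i ≡ row d S i
    F≡S = trans (row-dense d F (refl , refl) ¬p)
         (trans (cong₂ (denseCost (d i)) (bySide-dense ¬p) (bySide-dense ¬p)) (sym (row-dense d S cut ¬p)))

  xy-mono : ∀ i j → xyTerm F i j ≤ xyTerm S i j
  xy-mono i j = ifAndNot-mono (I≤ i) (J≥ j)

  column-b : ∀ i → xyTerm F i b + cx i ≤ xyTerm S i b
  column-b i with sparse-or-dense {γ = γ} i
  ... | inj₂ ¬p = ≤-+zero (bySide-dense ¬p) (xy-mono i b)
  ... | inj₁ p  = begin
    xyTerm F i b + cx i
      ≡⟨ cong₂ _+_ (xyTerm-sparse-dense F p b-dense) (bySide-sparse p) ⟩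
    𝟙 (I i ∧ not (J b)) + 𝟙 (S (x i) ∧ not (S (x' i p)))
      ≡⟨ cong (λ u → 𝟙 u + 𝟙 (S (x i) ∧ not (S (x' i p))))
              (cong₂ (λ u v → u ∧ not v) (bySide-sparse p) (trans (bySide-dense b-dense) Syb)) ⟩
    𝟙 ((S (x i) ∧ S (x' i p)) ∧ true) + 𝟙 (S (x i) ∧ not (S (x' i p)))
      ≤⟨ 𝟙-split-∧ (S (x i)) (S (x' i p)) ⟩
    𝟙 (S (x i) ∧ true)
      ≡⟨ trans (xyTerm-sparse-dense S p b-dense) (cong (λ v → 𝟙 (S (x i) ∧ not v)) Syb) ⟨
    xyTerm S i b ∎
    where open ≤-Reasoning

  row-a : ∀ j → xyTerm F a j + cy j ≤ xyTerm S a j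
  row-a j with sparse-or-dense {γ = γ} j
  ... | inj₂ ¬q = ≤-+zero (bySide-dense ¬q) (xy-mono a j)
  ... | inj₁ q  = begin
    xyTerm F a j + cy j
      ≡⟨ cong₂ _+_ (xyTerm-dense-sparse F a-dense q) (bySide-sparse q) ⟩
    𝟙 (I a ∧ not (J j)) + 𝟙 (not (S (y j)) ∧ S (y' j q))
      ≡⟨ cong (λ u → 𝟙 u + 𝟙 (not (S (y j)) ∧ S (y' j q)))
              (cong₂ (λ u v → u ∧ not v) (trans (bySide-dense a-dense) Sxa) (bySide-sparse q)) ⟩
    𝟙 (not (S (y j) ∨ S (y' j q))) + 𝟙 (not (S (y j)) ∧ S (y' j q))
      ≤⟨ 𝟙-split-∨ (S (y j)) (S (y' j q)) ⟩
    𝟙 (not (S (y j)))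
      ≡⟨ trans (xyTerm-dense-sparse S a-dense q) (cong (λ u → 𝟙 (u ∧ not (S (y j)))) Sxa) ⟨
    xyTerm S a j ∎
    where open ≤-Reasoning

  xy≤ : ∑[ i < n ] ∑[ j < n ] xyTerm F i j + ∑[ i < n ] (cx i + cy i) ≤ ∑[ i < n ] ∑[ j < n ] xyTerm S i j
  xy≤ = begin
    ∑[ i < n ] ∑[ j < n ] xyTerm F i j + ∑[ i < n ] (cx i + cy i)
      ≡⟨ cong (∑[ i < n ] ∑[ j < n ] xyTerm F i j +_) (∑-distrib-+ cx cy) ⟩
    ∑[ i < n ] ∑[ j < n ] xyTerm F i j + (∑[ i < n ] cx i + ∑[ i < n ] cy i)
      ≡⟨ +-assoc _ (∑[ i < n ] cx i) (∑[ i < n ] cy i) ⟨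
    ∑[ i < n ] ∑[ j < n ] xyTerm F i j + ∑[ i < n ] cx i + ∑[ i < n ] cy i
      ≤⟨ ∑∑-mono-≤-with-slack a b xy-mono column-b row-a (bySide-dense a-dense) ⟩
    ∑[ i < n ] ∑[ j < n ] xyTerm S i j ∎
    where open ≤-Reasoning

  toℱ₂ : ∃₂ λ I J → cutCap d (F2set {n} {γ} I J) ≤ cutCap d S
  toℱ₂ = I , J , cutCap-≤ d F S (λ i → cx i + cy i) row≤ xy≤ (∑∑primePrimeTerm-mono F S x'≤ y'≥)
    where
    x'≤ : ∀ i p → I i ≤ᴮ S (x' i p)
    x'≤ i p = subst (_≤ᴮ S (x' i p)) (sym (bySide-sparse p)) (∧-≤ᴮʳ _ _)
    y'≥ : ∀ j q → S (y' j q) ≤ᴮ J j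
    y'≥ j q = subst (S (y' j q) ≤ᴮ_) (sym (bySide-sparse q)) (∨-≥ᴮʳ _ _)
-- The ℱ₃ witness on a sparse gadget, in terms of the S-memberships a, c, b, e of x_i, x'_i, y_i, y'_i.
keepX : (a c b e : Bool) → Bool
keepX a c b e = not (e ∨ b) ∧ (a ∧ c)

keepY' : (a c e : Bool) → Bool
keepY' a c e = e ∧ not (a ∧ c)

keepX≤¬b : ∀ a c b e → keepX a c b e ≤ᴮ not b
keepX≤¬b a c b true  = ≤ᴮ-minimum (not b)
keepX≤¬b a c b false = ∧-≤ᴮˡ (not b) (a ∧ c)

keep-row≤ : ∀ {d} → 1 ≤ d → ∀ a c b e →
  sourceCost d (keepX a c b e) (keepX a c b e) + sinkCost d false (keepY' a c e)
    ≤ sourceCost d a c + sinkCost d b e + 𝟙 (not b ∧ not (keepX a c b e))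
keep-row≤     1≤d true  true  true  true  = ≤-refl
keep-row≤ {d} 1≤d true  true  false true  = ≤-trans (≤-reflexive (+-identityʳ (d + 0))) (d+0≤d∸1+1 1≤d)
keep-row≤ {d} 1≤d true  false true  true  = ≤-trans (≤-reflexive (+-comm (d + 0) (d ∸ 1))) (m≤m+n _ 0)
keep-row≤ {d} 1≤d true  false false true  =
  ≤-trans (+-monoˡ-≤ (d ∸ 1) (d+0≤d∸1+1 1≤d)) (≤-reflexive (xy∙z≈xz∙y (d ∸ 1) 1 (d ∸ 1)))
keep-row≤ {d} 1≤d false c     true  true  =
  ≤-trans (+-monoʳ-≤ (d + 0) (≤-trans (m∸n≤m d 1) (m≤m+n d 0))) (m≤m+n _ 0)
keep-row≤ {d} 1≤d false c     false true  = m≤m+n _ 1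
keep-row≤ {d} 1≤d a     c     true  false = +-monoˡ-≤ 0 (m≤n+m (d + 0) (sourceCost d a c))
keep-row≤     1≤d true  true  false false = z≤n
keep-row≤ {d} 1≤d true  false false false =
  ≤-trans (≤-reflexive (+-identityʳ (d + 0)))
          (≤-trans (d+0≤d∸1+1 1≤d) (≤-reflexive (cong (_+ 1) (sym (+-identityʳ (d ∸ 1))))))
keep-row≤ {d} 1≤d false c     false false = m≤m+n _ 1

keepX-transpose≤ : ∀ u b xⱼ → u ≤ᴮ not b → 𝟙 (u ∧ not (not xⱼ)) ≤ 𝟙 (xⱼ ∧ not b)
keepX-transpose≤ false b     xⱼ    _ = z≤n
keepX-transpose≤ true  false true  _ = ≤-refl
keepX-transpose≤ true  false false _ = z≤n
keepX-transpose≤ true  true  xⱼ    ()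

keepX-credit≤ : ∀ u b → u ≤ᴮ not b → 𝟙 (u ∧ true) + 𝟙 (not b ∧ not u) ≤ 𝟙 (not b)
keepX-credit≤ false true  _ = z≤n
keepX-credit≤ false false _ = ≤-refl
keepX-credit≤ true  false _ = ≤-refl
keepX-credit≤ true  true  ()

𝟙-∧-not-not≤ : ∀ p q r → q ≤ᴮ r → 𝟙 (p ∧ not (not q)) ≤ 𝟙 (r ∧ true)
𝟙-∧-not-not≤ false q     r     _ = z≤n
𝟙-∧-not-not≤ true  false r     _ = z≤n
𝟙-∧-not-not≤ true  true  true  _ = ≤-refl
𝟙-∧-not-not≤ true  true  false ()

keepX≤c : ∀ a c b → keepX a c b false ≤ᴮ c
keepX≤c a c b = ≤ᴮ-trans (∧-≤ᴮʳ (not b) (a ∧ c)) (∧-≤ᴮʳ a c)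

-- If the witness cuts x'_i→y'_j but S does not, then x'_j, y'_j ∈ S and y'_i ∉ S, so S cuts the
-- reverse edge x'_j→y'_i, which the witness does not (it drops x'_j since y'_j ∈ S).
keep-cross≤ : ∀ aᵢ cᵢ bᵢ eᵢ aⱼ cⱼ bⱼ eⱼ →
  𝟙 (keepX aᵢ cᵢ bᵢ eᵢ ∧ not (keepY' aⱼ cⱼ eⱼ)) + 𝟙 (keepX aⱼ cⱼ bⱼ eⱼ ∧ not (keepY' aᵢ cᵢ eᵢ))
    ≤ 𝟙 (cᵢ ∧ not eⱼ) + 𝟙 (cⱼ ∧ not eᵢ)
keep-cross≤ aᵢ cᵢ bᵢ false aⱼ cⱼ bⱼ false =
  +-mono-≤ (ifAndNot-mono (keepX≤c aᵢ cᵢ bᵢ) b≤b) (ifAndNot-mono (keepX≤c aⱼ cⱼ bⱼ) b≤b)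
keep-cross≤ aᵢ cᵢ bᵢ false aⱼ cⱼ bⱼ true  =
  ≤-+zero refl (≤-trans (𝟙-∧-not-not≤ (keepX aᵢ cᵢ bᵢ false) (aⱼ ∧ cⱼ) cⱼ (∧-≤ᴮʳ aⱼ cⱼ)) (m≤n+m _ _))
keep-cross≤ aᵢ cᵢ bᵢ true  aⱼ cⱼ bⱼ false =
  ≤-trans (𝟙-∧-not-not≤ (keepX aⱼ cⱼ bⱼ false) (aᵢ ∧ cᵢ) cᵢ (∧-≤ᴮʳ aᵢ cᵢ)) (m≤m+n _ _)
keep-cross≤ aᵢ cᵢ bᵢ true  aⱼ cⱼ bⱼ true  = z≤n

denseCost-flip : ∀ d a → denseCost d false (not a) ≡ denseCost d a true
denseCost-flip d true  = +-identityʳ d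
denseCost-flip d false = refl

module From𝒮₁₀ {n γ : ℕ} (d : Fin n → ℕ) (d≥1 : ∀ i → 1 ≤ d i) (S : VSet n γ) (cut : IsCut S)
  (a : Fin n) (a-dense : ¬ γ ≤ toℕ a) (Sxa : S (x a) ≡ true)
  (allYD : ∀ j → toℕ j < γ → S (y j) ≡ true) where

  keepXᵢ : (i : Fin n) → γ ≤ toℕ i → Bool
  keepXᵢ i p = keepX (S (x i)) (S (x' i p)) (S (y i)) (S (y' i p))

  keepXᵢ≤¬y : ∀ i p → keepXᵢ i p ≤ᴮ not (S (y i))
  keepXᵢ≤¬y i p = keepX≤¬b (S (x i)) (S (x' i p)) (S (y i)) (S (y' i p))

  I J : Fin n → Bool
  I = bySide (λ _ → false) keepXᵢ
  J = bySide (λ j → not (S (x j))) (λ j q → keepY' (S (x j)) (S (x' j q)) (S (y' j q)))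

  F : VSet n γ
  F = F3set I J

  -- Paid by the edge x_a→y_i, which S cuts whenever y_i ∉ S.
  cr : Fin n → ℕ
  cr = bySide (λ _ → 0) (λ i p → 𝟙 (not (S (y i)) ∧ not (keepXᵢ i p)))

  Fx-sparse : ∀ {i} (p : γ ≤ toℕ i) → F (x i) ≡ keepXᵢ i p
  Fx-sparse {i} p = trans (cong (I i ∧_) (isS-sparse p)) (trans (∧-identityʳ (I i)) (bySide-sparse p))

  Fx-dense : ∀ {i} → ¬ γ ≤ toℕ i → F (x i) ≡ false
  Fx-dense {i} ¬p = trans (cong (I i ∧_) (isS-dense ¬p)) (∧-zeroʳ (I i))

  Fy-sparse : ∀ {j} → γ ≤ toℕ j → F (y j) ≡ false
  Fy-sparse {j} q = trans (cong (J j ∧_) (isD-sparse q)) (∧-zeroʳ (J j))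

  Fy-dense : ∀ {j} → ¬ γ ≤ toℕ j → F (y j) ≡ not (S (x j))
  Fy-dense {j} ¬q = trans (cong (J j ∧_) (isD-dense ¬q)) (trans (∧-identityʳ (J j)) (bySide-dense ¬q))

  row≤-sparse : ∀ i (p : γ ≤ toℕ i) → row d F i ≤ row d S i + cr i
  row≤-sparse i p = begin
    row d F i
      ≡⟨ row-sparse d F (refl , refl) p ⟩
    sourceCost (d i) (F (x i)) (I i) + sinkCost (d i) (F (y i)) (J i)
      ≡⟨ cong₂ _+_ (cong₂ (sourceCost (d i)) (Fx-sparse p) (bySide-sparse p))
                   (cong₂ (sinkCost (d i)) (Fy-sparse p) (bySide-sparse p)) ⟩
    sourceCost (d i) (keepXᵢ i p) (keepXᵢ i p) + sinkCost (d i) false (keepY' xᵢ x'ᵢ y'ᵢ)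
      ≤⟨ keep-row≤ (d≥1 i) xᵢ x'ᵢ yᵢ y'ᵢ ⟩
    sourceCost (d i) xᵢ x'ᵢ + sinkCost (d i) yᵢ y'ᵢ + 𝟙 (not yᵢ ∧ not (keepXᵢ i p))
      ≡⟨ cong₂ _+_ (row-sparse d S cut p) (bySide-sparse p) ⟨
    row d S i + cr i ∎
    where
    open ≤-Reasoning
    xᵢ x'ᵢ yᵢ y'ᵢ : Bool
    xᵢ = S (x i)
    x'ᵢ = S (x' i p)
    yᵢ = S (y i)
    y'ᵢ = S (y' i p)

  row≡-dense : ∀ i → ¬ γ ≤ toℕ i → row d F i ≡ row d S i
  row≡-dense i ¬p = begin
    row d F i                              ≡⟨ row-dense d F (refl , refl) ¬p ⟩
    denseCost (d i) (F (x i)) (F (y i))    ≡⟨ cong₂ (denseCost (d i)) (Fx-dense ¬p) (Fy-dense ¬p) ⟩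
    denseCost (d i) false (not (S (x i)))  ≡⟨ denseCost-flip (d i) (S (x i)) ⟩
    denseCost (d i) (S (x i)) true         ≡⟨ cong (denseCost (d i) (S (x i))) (allYD i (≰⇒> ¬p)) ⟨
    denseCost (d i) (S (x i)) (S (y i))    ≡⟨ row-dense d S cut ¬p ⟨
    row d S i                              ∎
    where open ≡-Reasoning

  row≤ : ∀ i → row d F i ≤ row d S i + cr i
  row≤ i with sparse-or-dense {γ = γ} i
  ... | inj₁ p  = row≤-sparse i p
  ... | inj₂ ¬p = ≤-trans (≤-reflexive (row≡-dense i ¬p)) (m≤m+n _ _)

  xyTerm-dense≡0 : ∀ {i} j → ¬ γ ≤ toℕ i → xyTerm F i j ≡ 0
  xyTerm-dense≡0 {i} j ¬p = cong (λ u → if u ∧ not (F (y j)) then xyCap γ i j else 0) (Fx-dense ¬p)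

  transposed : ∀ i j → xyTerm F i j ≤ xyTerm S j i
  transposed i j with sparse-or-dense {γ = γ} i | sparse-or-dense {γ = γ} j
  ... | inj₂ ¬p | _       = ≤-trans (≤-reflexive (xyTerm-dense≡0 j ¬p)) z≤n
  ... | inj₁ p  | inj₁ q  = ≤-trans (≤-reflexive (xyTerm-sparse-sparse F p q)) z≤n
  ... | inj₁ p  | inj₂ ¬q = begin
    xyTerm F i j
      ≡⟨ xyTerm-sparse-dense F p ¬q ⟩
    𝟙 (F (x i) ∧ not (F (y j)))
      ≡⟨ cong₂ (λ u v → 𝟙 (u ∧ not v)) (Fx-sparse p) (Fy-dense ¬q) ⟩
    𝟙 (keepXᵢ i p ∧ not (not (S (x j))))
      ≤⟨ keepX-transpose≤ (keepXᵢ i p) (S (y i)) (S (x j)) (keepXᵢ≤¬y i p) ⟩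
    𝟙 (S (x j) ∧ not (S (y i)))
      ≡⟨ xyTerm-dense-sparse S ¬q p ⟨
    xyTerm S j i ∎
    where open ≤-Reasoning

  column-a : ∀ i → xyTerm F i a + cr i ≤ xyTerm S a i
  column-a i with sparse-or-dense {γ = γ} i
  ... | inj₂ ¬p = ≤-trans (≤-reflexive (cong₂ _+_ (xyTerm-dense≡0 a ¬p) (bySide-dense ¬p))) z≤n
  ... | inj₁ p  = begin
    xyTerm F i a + cr i
      ≡⟨ cong₂ _+_ (xyTerm-sparse-dense F p a-dense) (bySide-sparse p) ⟩
    𝟙 (F (x i) ∧ not (F (y a))) + 𝟙 (not (S (y i)) ∧ not (keepXᵢ i p))
      ≡⟨ cong (λ u → 𝟙 u + 𝟙 (not (S (y i)) ∧ not (keepXᵢ i p)))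
              (cong₂ (λ u v → u ∧ not v) (Fx-sparse p) (trans (Fy-dense a-dense) (cong not Sxa))) ⟩
    𝟙 (keepXᵢ i p ∧ true) + 𝟙 (not (S (y i)) ∧ not (keepXᵢ i p))
      ≤⟨ keepX-credit≤ (keepXᵢ i p) (S (y i)) (keepXᵢ≤¬y i p) ⟩
    𝟙 (not (S (y i)))
      ≡⟨ trans (xyTerm-dense-sparse S a-dense p) (cong (λ u → 𝟙 (u ∧ not (S (y i)))) Sxa) ⟨
    xyTerm S a i ∎
    where open ≤-Reasoning

  xy≤ : ∑[ i < n ] ∑[ j < n ] xyTerm F i j + ∑[ i < n ] cr i ≤ ∑[ i < n ] ∑[ j < n ] xyTerm S i j
  xy≤ = begin
    ∑[ i < n ] ∑[ j < n ] xyTerm F i j + ∑[ i < n ] cr i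
      ≡⟨ trans (cong (∑[ i < n ] ∑[ j < n ] xyTerm F i j + ∑[ i < n ] cr i +_) (sum-replicate-zero n))
               (+-identityʳ _) ⟨
    ∑[ i < n ] ∑[ j < n ] xyTerm F i j + ∑[ i < n ] cr i + ∑[ j < n ] 0
      ≤⟨ ∑∑-mono-≤-with-slack a a transposed column-a (λ j → ≤-+zero refl (transposed a j))
                              (bySide-dense a-dense) ⟩
    ∑[ i < n ] ∑[ j < n ] xyTerm S j i
      ≡⟨ ∑-comm (λ i j → xyTerm S j i) ⟩
    ∑[ j < n ] ∑[ i < n ] xyTerm S j i ∎
    where open ≤-Reasoning

  cross≤ : ∀ i j p q → crossTerm F i j p q ≤ crossTerm S i j p q
  cross≤ i j p q = subst (_≤ crossTerm S i j p q)
    (sym (cong₂ _+_ (cong₂ (λ u v → 𝟙 (u ∧ not v)) (bySide-sparse p) (bySide-sparse q))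
                    (cong₂ (λ u v → 𝟙 (u ∧ not v)) (bySide-sparse q) (bySide-sparse p))))
    (keep-cross≤ (S (x i)) (S (x' i p)) (S (y i)) (S (y' i p)) (S (x j)) (S (x' j q)) (S (y j)) (S (y' j q)))

  toℱ₃ : ∃₂ λ I J → cutCap d (F3set {n} {γ} I J) ≤ cutCap d S
  toℱ₃ = I , J , cutCap-≤ d F S cr row≤ xy≤ (∑∑primePrimeTerm-≤ F S cross≤)

corollary1 : (n : ℕ) (d : Fin n → ℕ) → (∀ i → 1 ≤ d i) → (γ : ℕ) → 1 ≤ γ → γ ≤ n →
    ((S : VSet n γ) → IsCut S → InS00 S →
      ∃₂ λ (I J : Fin n → Bool) → cutCap d (F1set {n} {γ} I J) ≤ cutCap d S)
    × ((S : VSet n γ) → IsCut S → InS11 S →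
      ∃₂ λ (I J : Fin n → Bool) → cutCap d (F2set {n} {γ} I J) ≤ cutCap d S)
    × ((S : VSet n γ) → IsCut S → InS10 S →
      ∃₂ λ (I J : Fin n → Bool) → cutCap d (F3set {n} {γ} I J) ≤ cutCap d S)
corollary1 n d d≥1 γ _ _ =
    (λ S cut (noXD , allYD) → From𝒮₀₀.toℱ₁ d S cut noXD allYD)
  , (λ S cut ((a , a<γ , Sxa) , (b , b<γ , Syb)) →
       From𝒮₁₁.toℱ₂ d d≥1 S cut a (<⇒≱ a<γ) Sxa b (<⇒≱ b<γ) Syb)
  , (λ S cut ((a , a<γ , Sxa) , allYD) → From𝒮₁₀.toℱ₃ d d≥1 S cut a (<⇒≱ a<γ) Sxa allYD)
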